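{- The assertional logic of $\mathsf{ROL}$ is algebraizable in the sense of Blok and Pigozzi, and its equivalent algebraic semantics is $\mathsf{ROL}$.
   Context: A residuated ortholattice is an algebra $(A,\wedge,\vee,\neg,\backslash,0,1)$ where $(A,\wedge,\vee,0,1)$ is a bounded lattice, $\neg$ is an order-reversing involution, and $x\cdot y\le z\iff y\le x\backslash z$ for all $x,y,z$, where $x\cdot y:=x\wedge(\neg x\vee y)$; $\mathsf{ROL}$ denotes the variety of these. For a class $\mathsf K$ of algebras in a language $\mathcal L$ containing a constant $1$, the assertional logic of $\mathsf K$ is the logic $(\mathcal L,\vdash_{\mathsf K})$ with $\Gamma\vdash_{\mathsf K}\varphi$ iff $\{\gamma\approx1:\gamma\in\Gamma\}\models_{\mathsf K}\varphi\approx 1$, where $\models_{\mathsf K}$ is the relative equational consequence of $\mathsf K$ (an equation follows from a set of equations if every assignment in every member of $\mathsf K$ satisfying all the premises satisfies the conclusion). -}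

module Defs where

open import Level using (0ℓ)
open import Data.Nat using (ℕ)
open import Data.Fin using (Fin; zero; suc)
open import Data.Product using (_×_; _,_; Σ; ∃)
open import Data.List using (List)
open import Data.List.Membership.Propositional using (_∈_)
open import Relation.Unary using (Pred; ｛_｝)
open import Relation.Binary.PropositionalEquality using (_≡_)
open import Function.Bundles using (_⇔_)

record ROL : Set₁ where
  infixr 7 _∧_
  infixr 6 _∨_
  field
    Carrier : Set
    _∧_ _∨_ _\\_ : Carrier → Carrier → Carrier
    ¬_ : Carrier → Carrier
    𝟘 𝟙 : Carrier
    ∧-assoc : ∀ x y z → (x ∧ y) ∧ z ≡ x ∧ (y ∧ z)
    ∨-assoc : ∀ x y z → (x ∨ y) ∨ z ≡ x ∨ (y ∨ z)
    ∧-comm  : ∀ x y → x ∧ y ≡ y ∧ x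
    ∨-comm  : ∀ x y → x ∨ y ≡ y ∨ x
    ∧-absorbs-∨ : ∀ x y → x ∧ (x ∨ y) ≡ x
    ∨-absorbs-∧ : ∀ x y → x ∨ (x ∧ y) ≡ x
    𝟘-least : ∀ x → 𝟘 ∧ x ≡ 𝟘
    𝟙-greatest : ∀ x → x ∧ 𝟙 ≡ x
  _≤_ : Carrier → Carrier → Set
  x ≤ y = x ∧ y ≡ x
  _·_ : Carrier → Carrier → Carrier
  x · y = x ∧ (¬ x ∨ y)
  field
    ¬-involutive : ∀ x → ¬ (¬ x) ≡ x
    ¬-antitone   : ∀ x y → x ≤ y → (¬ y) ≤ (¬ x)
    residuated : ∀ x y z → ((x · y) ≤ z) ⇔ (y ≤ (x \\ z))

data Term (V : Set) : Set where
  var  : V → Term V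
  _∧'_ _∨'_ _\\'_ : Term V → Term V → Term V
  ¬'_  : Term V → Term V
  0' 1' : Term V

_[_] : ∀ {V W : Set} → Term V → (V → Term W) → Term W
var v     [ σ ] = σ v
(s ∧' t)  [ σ ] = (s [ σ ]) ∧' (t [ σ ])
(s ∨' t)  [ σ ] = (s [ σ ]) ∨' (t [ σ ])
(s \\' t) [ σ ] = (s [ σ ]) \\' (t [ σ ])
(¬' s)    [ σ ] = ¬' (s [ σ ])
0'        [ σ ] = 0'
1'        [ σ ] = 1'

Fm : Set
Fm = Term ℕ

⟦_⟧ : ∀ {V : Set} → Term V → (A : ROL) → (V → ROL.Carrier A) → ROL.Carrier A
⟦ var v ⟧     A ρ = ρ v
⟦ s ∧' t ⟧    A ρ = ROL._∧_ A (⟦ s ⟧ A ρ) (⟦ t ⟧ A ρ)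
⟦ s ∨' t ⟧    A ρ = ROL._∨_ A (⟦ s ⟧ A ρ) (⟦ t ⟧ A ρ)
⟦ s \\' t ⟧   A ρ = ROL._\\_ A (⟦ s ⟧ A ρ) (⟦ t ⟧ A ρ)
⟦ ¬' s ⟧      A ρ = ROL.¬_ A (⟦ s ⟧ A ρ)
⟦ 0' ⟧        A ρ = ROL.𝟘 A
⟦ 1' ⟧        A ρ = ROL.𝟙 A

Eqn : Set → Set
Eqn V = Term V × Term V

Sat : (A : ROL) → (ℕ → ROL.Carrier A) → Eqn ℕ → Set
Sat A ρ (s , t) = ⟦ s ⟧ A ρ ≡ ⟦ t ⟧ A ρ

_⊨_ : Pred (Eqn ℕ) 0ℓ → Eqn ℕ → Set₁
Θ ⊨ e = (A : ROL) (ρ : ℕ → ROL.Carrier A) →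
        (∀ e' → Θ e' → Sat A ρ e') → Sat A ρ e

_⊨ˢ_ : Pred (Eqn ℕ) 0ℓ → Pred (Eqn ℕ) 0ℓ → Set₁
Θ ⊨ˢ Ψ = ∀ e → Ψ e → Θ ⊨ e

_⊢_ : Pred Fm 0ℓ → Fm → Set₁
Γ ⊢ φ = (λ e → Σ Fm λ γ → Γ γ × (e ≡ (γ , 1'))) ⊨ (φ , 1')

E⟨_⟩ : List (Eqn (Fin 1)) → Fm → Pred (Eqn ℕ) 0ℓ
E⟨ E ⟩ φ e = Σ (Eqn (Fin 1)) λ { (δ , ε) →
               ((δ , ε) ∈ E) × (e ≡ (δ [ (λ _ → φ) ] , ε [ (λ _ → φ) ])) }

E[_]⟨_⟩ : List (Eqn (Fin 1)) → Pred Fm 0ℓ → Pred (Eqn ℕ) 0ℓ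
E[ E ]⟨ Γ ⟩ e = Σ Fm λ γ → Γ γ × E⟨ E ⟩ γ e

Δ⟨_⟩ : List (Term (Fin 2)) → Fm → Fm → Pred Fm 0ℓ
Δ⟨ Δ ⟩ s t φ = Σ (Term (Fin 2)) λ d →
               (d ∈ Δ) × (φ ≡ d [ (λ { zero → s ; (suc _) → t }) ])

-- Algebraizability of the assertional logic ⊢ of ROL with
-- equivalent algebraic semantics ROL (Blok–Pigozzi):
-- there are finite E(x) and Δ(x,y) with
--  (i)  Γ ⊢ φ  iff  E[Γ] ⊨_ROL E(φ)
--  (ii) x ≈ y  =||=_ROL  E[Δ(x,y)]
AlgebraizableWithSemanticsROL : Set₁
AlgebraizableWithSemanticsROL =
  Σ (List (Eqn (Fin 1))) λ E → Σ (List (Term (Fin 2))) λ Δ →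
    ((Γ : Pred Fm 0ℓ) (φ : Fm) → (Γ ⊢ φ → E[ E ]⟨ Γ ⟩ ⊨ˢ E⟨ E ⟩ φ)
                                × (E[ E ]⟨ Γ ⟩ ⊨ˢ E⟨ E ⟩ φ → Γ ⊢ φ))
    × (｛ (var 0 , var 1) ｝ ⊨ˢ E[ E ]⟨ Δ⟨ Δ ⟩ (var 0) (var 1) ⟩)
    × (E[ E ]⟨ Δ⟨ Δ ⟩ (var 0) (var 1) ⟩ ⊨ (var 0 , var 1))

{-# OPTIONS --safe #-}
-- Take E(x) = {x ≈ 1} and Δ(x, y) = {x \ y, y \ x}.  Since x · 1 = x,
-- residuation at y = 1 says that x \ z = 1 exactly when x ≤ z.  Hence
-- E[Δ(x, y)] says x ≤ y and y ≤ x, which is equivalent to x ≈ y; and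
-- E[Γ] is literally the set of premises {γ ≈ 1 : γ ∈ Γ} of ⊢, so (i) holds
-- on the nose.
module Submission where

open import Defs
open import Level using (0ℓ)
open import Data.Nat using (ℕ)
open import Data.Fin using (Fin; zero; suc)
open import Data.Product using (_×_; _,_; Σ)
open import Data.List using (List; []; _∷_)
open import Data.List.Relation.Unary.Any using (here; there)
open import Relation.Unary using (Pred; _⊆_; ｛_｝)
open import Relation.Binary.PropositionalEquality
open import Function.Bundles using (_⇔_; Equivalence; mk⇔)

module ROL-Properties (A : ROL) where
  open ROL A
  open ≡-Reasoning

  ∨-zeroˡ : ∀ x → 𝟙 ∨ x ≡ 𝟙
  ∨-zeroˡ x = begin
    𝟙 ∨ x        ≡⟨ cong (𝟙 ∨_) (sym (trans (∧-comm 𝟙 x) (𝟙-greatest x))) ⟩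
    𝟙 ∨ (𝟙 ∧ x)  ≡⟨ ∨-absorbs-∧ 𝟙 x ⟩
    𝟙            ∎

  ∨-zeroʳ : ∀ x → x ∨ 𝟙 ≡ 𝟙
  ∨-zeroʳ x = trans (∨-comm x 𝟙) (∨-zeroˡ x)

  ·-identityʳ : ∀ x → x · 𝟙 ≡ x
  ·-identityʳ x = trans (cong (x ∧_) (∨-zeroʳ (¬ x))) (𝟙-greatest x)

  ≤-refl : ∀ x → x ≤ x
  ≤-refl x = begin
    x ∧ x              ≡⟨ cong (x ∧_) (sym (∨-absorbs-∧ x x)) ⟩
    x ∧ (x ∨ (x ∧ x))  ≡⟨ ∧-absorbs-∨ x (x ∧ x) ⟩
    x                  ∎

  ≤-antisym : ∀ x y → x ≤ y → y ≤ x → x ≡ y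
  ≤-antisym x y x≤y y≤x = trans (sym x≤y) (trans (∧-comm x y) y≤x)

  𝟙≤⇔≡𝟙 : ∀ z → 𝟙 ≤ z ⇔ z ≡ 𝟙
  𝟙≤⇔≡𝟙 z = mk⇔ (λ 𝟙≤z → trans (sym (𝟙-greatest z)) (trans (∧-comm z 𝟙) 𝟙≤z))
                (λ { refl → 𝟙-greatest 𝟙 })

  \\≡𝟙⇔≤ : ∀ x y → x \\ y ≡ 𝟙 ⇔ x ≤ y
  \\≡𝟙⇔≤ x y = mk⇔
    (λ x\\y≡𝟙 → subst (λ w → w ≤ y) (·-identityʳ x)
       (Equivalence.from (residuated x 𝟙 y) (Equivalence.from (𝟙≤⇔≡𝟙 _) x\\y≡𝟙)))
    (λ x≤y → Equivalence.to (𝟙≤⇔≡𝟙 _)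
       (Equivalence.to (residuated x 𝟙 y) (subst (λ w → w ≤ y) (sym (·-identityʳ x)) x≤y)))

  \\-self : ∀ x → x \\ x ≡ 𝟙
  \\-self x = Equivalence.from (\\≡𝟙⇔≤ x x) (≤-refl x)

  \\-antisym : ∀ x y → x \\ y ≡ 𝟙 → y \\ x ≡ 𝟙 → x ≡ y
  \\-antisym x y p q =
    ≤-antisym x y (Equivalence.to (\\≡𝟙⇔≤ x y) p) (Equivalence.to (\\≡𝟙⇔≤ y x) q)

open ROL-Properties

⊨-weaken : ∀ {Θ Θ′ : Pred (Eqn ℕ) 0ℓ} {e} → Θ ⊆ Θ′ → Θ ⊨ e → Θ′ ⊨ e
⊨-weaken Θ⊆Θ′ Θ⊨e A ρ sat = Θ⊨e A ρ (λ e′ e′∈Θ → sat e′ (Θ⊆Θ′ e′∈Θ))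

Assertions : Pred Fm 0ℓ → Pred (Eqn ℕ) 0ℓ
Assertions Γ e = Σ Fm λ γ → Γ γ × (e ≡ (γ , 1'))

E-≈1 : List (Eqn (Fin 1))
E-≈1 = (var zero , 1') ∷ []

Δ-residuals : List (Term (Fin 2))
Δ-residuals = (var zero \\' var (suc zero)) ∷ (var (suc zero) \\' var zero) ∷ []

E⟨φ⟩-intro : ∀ φ → E⟨ E-≈1 ⟩ φ (φ , 1')
E⟨φ⟩-intro φ = (var zero , 1') , here refl , refl

E[Γ]⊆Assertions : ∀ Γ → E[ E-≈1 ]⟨ Γ ⟩ ⊆ Assertions Γ
E[Γ]⊆Assertions Γ (γ , γ∈Γ , (_ , here refl , refl)) = γ , γ∈Γ , refl

Assertions⊆E[Γ] : ∀ Γ → Assertions Γ ⊆ E[ E-≈1 ]⟨ Γ ⟩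
Assertions⊆E[Γ] Γ (γ , γ∈Γ , refl) = γ , γ∈Γ , E⟨φ⟩-intro γ

⊢⇔E[Γ]⊨ˢE⟨φ⟩ : ∀ Γ φ → (Γ ⊢ φ → E[ E-≈1 ]⟨ Γ ⟩ ⊨ˢ E⟨ E-≈1 ⟩ φ)
                      × (E[ E-≈1 ]⟨ Γ ⟩ ⊨ˢ E⟨ E-≈1 ⟩ φ → Γ ⊢ φ)
⊢⇔E[Γ]⊨ˢE⟨φ⟩ Γ φ = to , from
  where
    to : Γ ⊢ φ → E[ E-≈1 ]⟨ Γ ⟩ ⊨ˢ E⟨ E-≈1 ⟩ φ
    to Γ⊢φ _ (_ , here refl , refl) = ⊨-weaken {e = φ , 1'} (Assertions⊆E[Γ] Γ) Γ⊢φ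
    from : E[ E-≈1 ]⟨ Γ ⟩ ⊨ˢ E⟨ E-≈1 ⟩ φ → Γ ⊢ φ
    from E[Γ]⊨E⟨φ⟩ = ⊨-weaken {e = φ , 1'} (E[Γ]⊆Assertions Γ) (E[Γ]⊨E⟨φ⟩ _ (E⟨φ⟩-intro φ))

x≈y⊨E[Δ] : ｛ (var 0 , var 1) ｝ ⊨ˢ E[ E-≈1 ]⟨ Δ⟨ Δ-residuals ⟩ (var 0) (var 1) ⟩
x≈y⊨E[Δ] _ (_ , (_ , here refl , refl) , (_ , here refl , refl)) A ρ sat =
  trans (cong (λ z → ROL._\\_ A z (ρ 1)) (sat _ refl)) (\\-self A (ρ 1))
x≈y⊨E[Δ] _ (_ , (_ , there (here refl) , refl) , (_ , here refl , refl)) A ρ sat =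
  trans (cong (ROL._\\_ A (ρ 1)) (sat _ refl)) (\\-self A (ρ 1))

E[Δ]⊨x≈y : E[ E-≈1 ]⟨ Δ⟨ Δ-residuals ⟩ (var 0) (var 1) ⟩ ⊨ (var 0 , var 1)
E[Δ]⊨x≈y A ρ sat = \\-antisym A (ρ 0) (ρ 1)
  (sat _ (_ , (_ , here refl , refl) , E⟨φ⟩-intro _))
  (sat _ (_ , (_ , there (here refl) , refl) , E⟨φ⟩-intro _))

theorem3p2 : AlgebraizableWithSemanticsROL
theorem3p2 = E-≈1 , Δ-residuals , ⊢⇔E[Γ]⊨ˢE⟨φ⟩ , x≈y⊨E[Δ] , E[Δ]⊨x≈y
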